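{- Let $P$ be a finite ranked poset and $A$ an antichain of $P$. Then (1) $\mathrm{supp}\big((\operatorname{row}_P^{ -1}\circ\operatorname{Rvac}_P)(A)\big)=\mathrm{supp}(A)$; (2) $(\operatorname{row}_P^{ -1}\circ\operatorname{Rvac}_P)(A)=(\operatorname{row}_{P_X}^{ -1}\circ\operatorname{Rvac}_{P_X})(A)$, where $X=\mathrm{supp}(A)$ and $A$ is regarded as an antichain of $P_X$.
   Context: A finite poset $Q$ is ranked if there is $\mathrm{rk}\colon Q\to\mathbb{N}$ with $\mathrm{rk}(q)=0$ for minimal $q$ and $\mathrm{rk}(y)=\mathrm{rk}(x)+1$ when $y$ covers $x$; $Q_i$ is the set of elements of rank $i$. For an antichain $A$ and $q\in Q$, the toggle $\tau_q(A)$ is $A\setminus\{q\}$ if $q\in A$, $A\cup\{q\}$ if $q\notin A$ and $A\cup\{q\}$ is an antichain, and $A$ otherwise; $\boldsymbol{\tau}_i$ is the composite of the commuting toggles $\tau_q$, $q\in Q_i$. With $R=\mathrm{rk}(Q)$ and composition right to left, rowmotion is $\operatorname{row}_Q=\boldsymbol{\tau}_R\cdots\boldsymbol{\tau}_0$ and rowvacuation is $\operatorname{Rvac}_Q=(\boldsymbol{\tau}_R)(\boldsymbol{\tau}_R\boldsymbol{\tau}_{R-1})\cdots(\boldsymbol{\tau}_R\cdots\boldsymbol{\tau}_0)$. For an antichain $A$ of $P$, its support is $\mathrm{supp}(A)=\{p\in P_0:p\le q\text{ for some }q\in A\}$. For $X\subseteq P_0$, $P_X=\{q\in P:q\not\ge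 p\text{ for all }p\in P_0\setminus X\}$, a ranked poset with the restricted order and rank function. -}

module Defs where

open import Data.Nat using (ℕ; zero; suc; _⊔_; _∸_; _+_)
import Data.Nat as ℕ
open import Data.Fin using (Fin)
open import Data.Fin.Properties using (all?; any?)
open import Data.Fin.Subset using (Subset; _∈_; _∉_; inside; outside; _∪_; ⁅_⁆; ⊤)
open import Data.Fin.Subset.Properties using (_∈?_)
open import Data.Vec using (tabulate; _[_]≔_)
open import Data.List using (List; []; _∷_; foldr; map; upTo; allFin; reverse; concatMap)
open import Data.Bool using (Bool; true; false; if_then_else_; _∧_)
open import Data.Product using (_×_; Σ)
open import Relation.Binary.PropositionalEquality using (_≡_; _≢_)
open import Relation.Binary.Structures using (IsDecPartialOrder)
open import Relation.Nullary using (¬_; Dec; does; _×-dec_; _→-dec_; ¬?)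

record RankedPoset (n : ℕ) : Set₁ where
  field
    _≤_ : Fin n → Fin n → Set
    isDecPartialOrder : IsDecPartialOrder _≡_ _≤_
    rk : Fin n → ℕ

  open IsDecPartialOrder isDecPartialOrder public
    using () renaming (_≤?_ to _≤?_; _≟_ to _≟_)

  _<_ : Fin n → Fin n → Set
  x < y = x ≤ y × x ≢ y

  Minimal : Fin n → Set
  Minimal q = ∀ p → p ≤ q → p ≡ q

  Covers : Fin n → Fin n → Set
  Covers y x = x < y × (∀ z → x < z → z ≤ y → z ≡ y)

  field
    rk-minimal : ∀ q → Minimal q → rk q ≡ 0
    rk-cover   : ∀ x y → Covers y x → rk y ≡ suc (rk x)

module _ {n : ℕ} (P : RankedPoset n) where
  open RankedPoset P

  IsAntichain : Subset n → Set
  IsAntichain A = ∀ p r → p ∈ A → r ∈ A → p ≤ r → p ≡ r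

  isAntichain? : (A : Subset n) → Dec (IsAntichain A)
  isAntichain? A =
    all? λ p → all? λ r → (p ∈? A) →-dec ((r ∈? A) →-dec ((p ≤? r) →-dec (p ≟ r)))

  toggle : Fin n → Subset n → Subset n
  toggle q A with does (q ∈? A)
  ... | true  = A [ q ]≔ outside
  ... | false = if does (isAntichain? (A ∪ ⁅ q ⁆)) then A [ q ]≔ inside else A

  -- Operations on the ranked subposet with ground set S (a down-set of P,
  -- with the restricted order and restricted rank function).
  -- The poset P itself is the case S = ⊤.

  -- τ_i of the subposet S: composite of the (commuting) toggles τ_q, q ∈ S, rk q = i
  toggleRank : Subset n → ℕ → Subset n → Subset n
  toggleRank S i A =
    foldr (λ q B → if does (q ∈? S) ∧ does (rk q ℕ.≟ i) then toggle q B else B)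
          A (allFin n)

  rankOf : Subset n → ℕ
  rankOf S = foldr _⊔_ 0 (map (λ q → if does (q ∈? S) then rk q else 0) (allFin n))

  -- apply τ_{i₁}, then τ_{i₂}, ... (list order = order of application)
  applyRanks : Subset n → List ℕ → Subset n → Subset n
  applyRanks S []       A = A
  applyRanks S (i ∷ is) A = applyRanks S is (toggleRank S i A)

  segment : ℕ → ℕ → List ℕ
  segment j R = map (j +_) (upTo (suc R ∸ j))

  row : Subset n → Subset n → Subset n
  row S = applyRanks S (upTo (suc (rankOf S)))

  -- row⁻¹ = τ_0 ⋯ τ_R  (each τ_i is an involution on antichains)
  rowInv : Subset n → Subset n → Subset n
  rowInv S = applyRanks S (reverse (upTo (suc (rankOf S))))

  -- Rvac = (τ_R)(τ_R τ_{R-1}) ⋯ (τ_R ⋯ τ_0): first τ_R⋯τ_0, then τ_R⋯τ_1, …, lastly τ_R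
  Rvac : Subset n → Subset n → Subset n
  Rvac S = applyRanks S (concatMap (λ j → segment j (rankOf S)) (upTo (suc (rankOf S))))

  supp : Subset n → Subset n
  supp A = tabulate λ p →
    if does (rk p ℕ.≟ 0) ∧ does (any? λ q → (q ∈? A) ×-dec (p ≤? q)) then inside else outside

  PX : Subset n → Subset n
  PX X = tabulate λ q →
    if does (all? λ p → ((rk p ℕ.≟ 0) ×-dec ¬? (p ∈? X)) →-dec ¬? (p ≤? q)) then inside else outside

{-# OPTIONS --safe #-}
module Submission where

-- Write X = supp A, Y = P₀ ∖ X and Q = P_X, the elements of P lying above no element of Y.
-- Since Rvac starts and row⁻¹ ends with τ₀, row⁻¹ ∘ Rvac is τ₀, then a word in the τᵢ with i > 0,
-- then τ₀ again. After the first τ₀ the antichain computed in P is the one computed in Q (which has no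
-- minimal elements) together with Y, and every τᵢ with i > 0 keeps it so: an element of rank i can be
-- added in P exactly when it lies in Q (it must not lie above Y) and can be added in Q (Y is
-- incomparable with Q). The final τ₀ removes Y and adds every element of X not yet covered, so both
-- computations end with the same antichain, of support X. The τᵢ of Q above the rank of Q are
-- identities, which lets both composites be computed with the rank of P.

open import Defs
open import Data.Nat as ℕ using (ℕ; zero; suc; _+_; _∸_; _⊔_; _⊓_; z≤n; s≤s)
open import Data.Nat.Properties
  using (≤-refl; ≤-trans; ≤-reflexive; <⇒≤; ≰⇒>; ≤⇒≯; m<n⇒m<1+n; m≤m⊔n; m≤n⇒m≤o⊔n; ⊔-lub;
         m≥n⇒m⊓n≡n; ⊓-zeroʳ; ∸-monoˡ-≤; m≤n⇒m∸n≡0; +-∸-assoc; +-identityʳ; +-suc)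
open import Data.Fin using (Fin)
open import Data.Fin.Properties using (any?; all?)
open import Data.Fin.Subset using (Subset; _∈_; _∉_; inside; outside; _∪_; ⁅_⁆; ⊤; _⊆_)
open import Data.Fin.Subset.Properties
  using (_∈?_; ∈⊤; x∈⁅x⁆; x∈⁅y⁆⇒x≡y; x∈p∪q⁺; x∈p∪q⁻; ⊆-antisym)
open import Data.Fin.Induction using (po-wellFounded; po-noetherian)
open import Data.Vec using (tabulate; _[_]≔_)
open import Data.Vec.Properties
  using ([]=⇒lookup; lookup⇒[]=; lookup∘update; lookup∘update′; lookup∘tabulate)
open import Data.List
  using (List; []; _∷_; _++_; [_]; foldr; map; concatMap; filter; reverse; drop;
         allFin; upTo; applyUpTo; applyDownFrom)
open import Data.List.Properties
  using (filter-++; filter-accept; filter-reject; ++-identityʳ; unfold-reverse; map-applyUpTo;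
         concatMap-cong; reverse-upTo; applyDownFrom-∷ʳ)
import Data.List.Membership.Propositional as List
open import Data.List.Membership.Propositional.Properties using (∈-allFin; ∈-map⁺)
open import Data.List.Relation.Unary.Any using (here; there)
open import Data.List.Relation.Unary.All using (All; []; _∷_)
open import Data.List.Relation.Unary.All.Properties
  using (All¬⇒¬Any; ++⁺; map⁺; concat⁺; applyUpTo⁺₂; applyDownFrom⁺₂)
open import Data.List.Relation.Unary.Unique.Propositional using (Unique)
open import Data.List.Relation.Unary.Unique.Propositional.Properties using (allFin⁺)
open import Data.List.Relation.Unary.AllPairs using ([]; _∷_)
open import Data.Bool using (if_then_else_)
open import Data.Product using (_×_; _,_; proj₁; proj₂; ∃)
open import Data.Sum as Sum using (_⊎_; inj₁; inj₂)
open import Function using (_∘_; flip; id)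
open import Function.Bundles using (_⇔_; mk⇔; Equivalence)
open import Function.Properties.Equivalence using () renaming (refl to ⇔-refl; sym to ⇔-sym; trans to ⇔-trans)
open import Induction.WellFounded using (Acc; acc)
open import Relation.Binary.PropositionalEquality
  using (_≡_; _≢_; refl; sym; trans; cong; cong₂; subst; module ≡-Reasoning)
open import Relation.Binary.Structures using (IsDecPartialOrder)
open import Relation.Nullary using (¬_; ¬?; Dec; yes; no; does; contradiction; _×-dec_; _→-dec_)
open import Relation.Nullary.Decidable using (dec-true; dec-false; decidable-stable)
open import Relation.Unary using (Pred; Decidable)

open Equivalence using (to; from)

consecutive : ℕ → ℕ → List ℕ
consecutive j zero    = []
consecutive j (suc m) = j ∷ consecutive (suc j) m

applyUpTo≡consecutive : ∀ {f : ℕ → ℕ} j m → (∀ x → f x ≡ j + x) → applyUpTo f m ≡ consecutive j m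
applyUpTo≡consecutive j zero    f≗j+ = refl
applyUpTo≡consecutive j (suc m) f≗j+ =
  cong₂ _∷_ (trans (f≗j+ 0) (+-identityʳ j))
            (applyUpTo≡consecutive (suc j) m (λ x → trans (f≗j+ (suc x)) (+-suc j x)))

filter-consecutive : ∀ k j m → filter (ℕ._≤? k) (consecutive j m) ≡ consecutive j (m ⊓ (suc k ∸ j))
filter-consecutive k j zero = refl
filter-consecutive k j (suc m) with j ℕ.≤? k
... | yes j≤k rewrite +-∸-assoc 1 j≤k =
  trans (filter-accept (ℕ._≤? k) j≤k) (cong (j ∷_) (filter-consecutive k (suc j) m))
... | no j≰k rewrite m≤n⇒m∸n≡0 (≰⇒> j≰k) = begin
  filter (ℕ._≤? k) (j ∷ consecutive (suc j) m) ≡⟨ filter-reject (ℕ._≤? k) j≰k ⟩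
  filter (ℕ._≤? k) (consecutive (suc j) m)     ≡⟨ filter-consecutive k (suc j) m ⟩
  consecutive (suc j) (m ⊓ (k ∸ j))            ≡⟨ cong (λ t → consecutive (suc j) (m ⊓ t)) k∸j≡0 ⟩
  consecutive (suc j) (m ⊓ 0)                  ≡⟨ cong (consecutive (suc j)) (⊓-zeroʳ m) ⟩
  []                                           ∎
  where
  open ≡-Reasoning
  k∸j≡0 : k ∸ j ≡ 0
  k∸j≡0 = m≤n⇒m∸n≡0 (<⇒≤ (≰⇒> j≰k))

filter-upTo : ∀ {k R} → k ℕ.≤ R → filter (ℕ._≤? k) (upTo (suc R)) ≡ upTo (suc k)
filter-upTo {k} {R} k≤R = begin
  filter (ℕ._≤? k) (upTo (suc R))          ≡⟨ cong (filter (ℕ._≤? k)) (upTo≡consecutive (suc R)) ⟩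
  filter (ℕ._≤? k) (consecutive 0 (suc R)) ≡⟨ filter-consecutive k 0 (suc R) ⟩
  consecutive 0 (suc R ⊓ suc k)            ≡⟨ cong (consecutive 0) (m≥n⇒m⊓n≡n (s≤s k≤R)) ⟩
  consecutive 0 (suc k)                    ≡⟨ upTo≡consecutive (suc k) ⟨
  upTo (suc k)                             ∎
  where
  open ≡-Reasoning
  upTo≡consecutive : ∀ m → upTo m ≡ consecutive 0 m
  upTo≡consecutive m = applyUpTo≡consecutive 0 m (λ _ → refl)

module _ {a p} {A : Set a} {P : Pred A p} (P? : Decidable P) where

  filter-concatMap : ∀ {b} {B : Set b} (f : B → List A) xs →
                     filter P? (concatMap f xs) ≡ concatMap (filter P? ∘ f) xs
  filter-concatMap f []       = refl
  filter-concatMap f (x ∷ xs) =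
    trans (filter-++ P? (f x) (concatMap f xs)) (cong (filter P? (f x) ++_) (filter-concatMap f xs))

  concatMap-filter : ∀ {b} {B : Set b} {f : A → List B} → (∀ {x} → ¬ P x → f x ≡ []) →
                     ∀ xs → concatMap f (filter P? xs) ≡ concatMap f xs
  concatMap-filter f≡[] []       = refl
  concatMap-filter {f = f} f≡[] (x ∷ xs) with P? x
  ... | yes _  = cong (f x ++_) (concatMap-filter f≡[] xs)
  ... | no ¬px rewrite f≡[] ¬px = concatMap-filter f≡[] xs

  filter-reverse : ∀ xs → filter P? (reverse xs) ≡ reverse (filter P? xs)
  filter-reverse []       = refl
  filter-reverse (x ∷ xs) = begin
    filter P? (reverse (x ∷ xs))              ≡⟨ cong (filter P?) (unfold-reverse x xs) ⟩
    filter P? (reverse xs ++ [ x ])           ≡⟨ filter-++ P? (reverse xs) [ x ] ⟩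
    filter P? (reverse xs) ++ filter P? [ x ] ≡⟨ cong (_++ filter P? [ x ]) (filter-reverse xs) ⟩
    reverse (filter P? xs) ++ filter P? [ x ] ≡⟨ snoc x ⟩
    reverse (filter P? (x ∷ xs))              ∎
    where
    open ≡-Reasoning
    snoc : ∀ x → reverse (filter P? xs) ++ filter P? [ x ] ≡ reverse (filter P? (x ∷ xs))
    snoc x with P? x
    ... | yes _ = sym (unfold-reverse x (filter P? xs))
    ... | no _  = ++-identityʳ (reverse (filter P? xs))

module _ {n : ℕ} (P : RankedPoset n) where
  open RankedPoset P renaming (_≤_ to _⊑_; _<_ to _⊏_; _≤?_ to _⊑?_)
  open IsDecPartialOrder isDecPartialOrder
    using (isPartialOrder) renaming (refl to ⊑-refl; trans to ⊑-trans)

  private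
    variable
      p q r x : Fin n
      B C S X : Subset n
      i k R : ℕ

  lowerCover-above : p ⊏ q → ∃ λ z → p ⊑ z × Covers q z
  lowerCover-above {p} {q} p⊏q = go p (po-noetherian isPartialOrder p) p⊏q
    where
    go : ∀ p → Acc (flip _⊏_) p → p ⊏ q → ∃ λ z → p ⊑ z × Covers q z
    go p (acc rec) p⊏q with any? (λ w → ((p ⊑? w) ×-dec ¬? (p ≟ w)) ×-dec ((w ⊑? q) ×-dec ¬? (w ≟ q)))
    ... | yes (w , p⊏w , w⊏q) =
      let z , w⊑z , z⋖q = go w (rec p⊏w) w⊏q in z , ⊑-trans (proj₁ p⊏w) w⊑z , z⋖q
    ... | no ∄w = p , ⊑-refl , p⊏q ,
      λ z p⊏z z⊑q → decidable-stable (z ≟ q) (λ z≢q → ∄w (z , p⊏z , z⊑q , z≢q))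

  rk-mono-< : p ⊏ q → rk p ℕ.< rk q
  rk-mono-< {p} {q} p⊏q = go q (po-wellFounded isPartialOrder q) p⊏q
    where
    go : ∀ q → Acc _⊏_ q → ∀ {p} → p ⊏ q → rk p ℕ.< rk q
    go q (acc rec) {p} p⊏q with lowerCover-above p⊏q
    ... | z , p⊑z , z⋖q with p ≟ z
    ...   | yes refl = ≤-reflexive (sym (rk-cover p q z⋖q))
    ...   | no p≢z   =
      subst (rk p ℕ.<_) (sym (rk-cover z q z⋖q)) (m<n⇒m<1+n (go z (rec (proj₁ z⋖q)) (p⊑z , p≢z)))

  ⊑∧rk≥⇒≡ : p ⊑ q → rk q ℕ.≤ rk p → p ≡ q
  ⊑∧rk≥⇒≡ {p} {q} p⊑q rk≥ = decidable-stable (p ≟ q) (λ p≢q → ≤⇒≯ rk≥ (rk-mono-< (p⊑q , p≢q)))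

  ⊑∧rk≡⇒≡ : p ⊑ q → rk p ≡ rk q → p ≡ q
  ⊑∧rk≡⇒≡ p⊑q rk≡ = ⊑∧rk≥⇒≡ p⊑q (≤-reflexive (sym rk≡))

  ⊑∧rk≡0⇒≡ : p ⊑ q → rk q ≡ 0 → p ≡ q
  ⊑∧rk≡0⇒≡ {p} p⊑q rk≡0 = ⊑∧rk≥⇒≡ p⊑q (subst (ℕ._≤ rk p) (sym rk≡0) z≤n)

  rk≤rankOf : q ∈ S → rk q ℕ.≤ rankOf P S
  rk≤rankOf {q} {S} q∈S = ≤-trans (rk≤entry (q ∈? S)) (∈⇒≤max (∈-map⁺ entry (∈-allFin q)))
    where
    entry : Fin n → ℕ
    entry p = if does (p ∈? S) then rk p else 0
    rk≤entry : (d : Dec (q ∈ S)) → rk q ℕ.≤ (if does d then rk q else 0)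
    rk≤entry (yes _)  = ≤-refl
    rk≤entry (no q∉S) = contradiction q∈S q∉S
    ∈⇒≤max : ∀ {m ms} → m List.∈ ms → m ℕ.≤ foldr _⊔_ 0 ms
    ∈⇒≤max (here refl) = m≤m⊔n _ _
    ∈⇒≤max (there m∈)  = m≤n⇒m≤o⊔n _ (∈⇒≤max m∈)

  rankOf-lub : (∀ {q} → q ∈ S → rk q ℕ.≤ R) → rankOf P S ℕ.≤ R
  rankOf-lub {S} {R} bound = go (allFin n)
    where
    entry≤ : ∀ q → (d : Dec (q ∈ S)) → (if does d then rk q else 0) ℕ.≤ R
    entry≤ q (yes q∈S) = bound q∈S
    entry≤ q (no _)    = z≤n
    go : ∀ qs → foldr _⊔_ 0 (map (λ q → if does (q ∈? S) then rk q else 0) qs) ℕ.≤ R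
    go []       = z≤n
    go (q ∷ qs) = ⊔-lub (entry≤ q (q ∈? S)) (go qs)

  ∈-update-other : r ≢ q → ∀ b → r ∈ (B [ q ]≔ b) ⇔ r ∈ B
  ∈-update-other {r} {q} {B} r≢q b = mk⇔
    (λ r∈ → lookup⇒[]= r B (trans (sym (lookup∘update′ r≢q B b)) ([]=⇒lookup r∈)))
    (λ r∈ → lookup⇒[]= r _ (trans (lookup∘update′ r≢q B b) ([]=⇒lookup r∈)))

  ∈-update-inside : q ∈ (B [ q ]≔ inside)
  ∈-update-inside {q} {B} = lookup⇒[]= q _ (lookup∘update q B inside)

  ∉-update-outside : q ∉ (B [ q ]≔ outside)
  ∉-update-outside {q} {B} q∈ with trans (sym (lookup∘update q B outside)) ([]=⇒lookup q∈)
  ... | ()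

  ∈-∪⁅⁆⁻ : x ∈ B ∪ ⁅ q ⁆ → x ∈ B ⊎ x ≡ q
  ∈-∪⁅⁆⁻ {B = B} {q} x∈ = Sum.map₂ (x∈⁅y⁆⇒x≡y q) (x∈p∪q⁻ B ⁅ q ⁆ x∈)

  Incomparable : Subset n → Fin n → Set
  Incomparable B r = ∀ b → b ∈ B → ¬ b ⊑ r × ¬ r ⊑ b

  Incomparable⇒∉ : Incomparable B r → r ∉ B
  Incomparable⇒∉ inc r∈B = proj₁ (inc _ r∈B) ⊑-refl

  Incomparable-cong : (∀ {b} → rk b ≢ rk r ⊎ b ≡ r → b ∈ B ⇔ b ∈ C) → Incomparable B r ⇔ Incomparable C r
  Incomparable-cong {r} agree = mk⇔ (transfer (from ∘ agree)) (transfer (to ∘ agree))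
    where
    transfer : ∀ {B C} → (∀ {b} → rk b ≢ rk r ⊎ b ≡ r → b ∈ C → b ∈ B) →
               Incomparable B r → Incomparable C r
    transfer agree′ inc b b∈C with rk b ℕ.≟ rk r | b ≟ r
    ... | no rk≢  | _       = inc b (agree′ (inj₁ rk≢) b∈C)
    ... | yes _   | yes b≡r = inc b (agree′ (inj₂ b≡r) b∈C)
    ... | yes rk≡ | no b≢r  =
      (λ b⊑r → b≢r (⊑∧rk≡⇒≡ b⊑r rk≡)) , (λ r⊑b → b≢r (sym (⊑∧rk≡⇒≡ r⊑b (sym rk≡))))

  Incomparable⇒∪-antichain : IsAntichain P B → Incomparable B q → IsAntichain P (B ∪ ⁅ q ⁆)
  Incomparable⇒∪-antichain antiB inc p r p∈ r∈ p⊑r with ∈-∪⁅⁆⁻ p∈ | ∈-∪⁅⁆⁻ r∈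
  ... | inj₁ p∈B  | inj₁ r∈B  = antiB p r p∈B r∈B p⊑r
  ... | inj₁ p∈B  | inj₂ refl = contradiction p⊑r (proj₁ (inc p p∈B))
  ... | inj₂ refl | inj₁ r∈B  = contradiction p⊑r (proj₂ (inc r r∈B))
  ... | inj₂ refl | inj₂ refl = refl

  ∪-antichain⇒Incomparable : q ∉ B → IsAntichain P (B ∪ ⁅ q ⁆) → Incomparable B q
  ∪-antichain⇒Incomparable {q} {B} q∉B anti b b∈B =
    (λ b⊑q → q∉B (subst (_∈ B) (anti b q b∈∪ q∈∪ b⊑q) b∈B)) ,
    (λ q⊑b → q∉B (subst (_∈ B) (sym (anti q b q∈∪ b∈∪ q⊑b)) b∈B))
    where
    b∈∪ : b ∈ B ∪ ⁅ q ⁆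
    b∈∪ = x∈p∪q⁺ (inj₁ b∈B)
    q∈∪ : q ∈ B ∪ ⁅ q ⁆
    q∈∪ = x∈p∪q⁺ (inj₂ (x∈⁅x⁆ q))

  toggle-self : IsAntichain P B → q ∈ toggle P q B ⇔ Incomparable B q
  toggle-self {B} {q} antiB with q ∈? B
  ... | yes q∈B = mk⇔ (λ q∈ → contradiction q∈ ∉-update-outside)
                      (λ inc → contradiction q∈B (Incomparable⇒∉ inc))
  ... | no q∉B  = add (isAntichain? P (B ∪ ⁅ q ⁆))
    where
    add : (d : Dec (IsAntichain P (B ∪ ⁅ q ⁆))) →
          q ∈ (if does d then B [ q ]≔ inside else B) ⇔ Incomparable B q
    add (yes anti) = mk⇔ (λ _ → ∪-antichain⇒Incomparable q∉B anti) (λ _ → ∈-update-inside)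
    add (no ¬anti) = mk⇔ (λ q∈B → contradiction q∈B q∉B)
                         (λ inc → contradiction (Incomparable⇒∪-antichain antiB inc) ¬anti)

  toggle-other : r ≢ q → r ∈ toggle P q B ⇔ r ∈ B
  toggle-other {r} {q} {B} r≢q with q ∈? B
  ... | yes _ = ∈-update-other r≢q outside
  ... | no _  = add (isAntichain? P (B ∪ ⁅ q ⁆))
    where
    add : (d : Dec (IsAntichain P (B ∪ ⁅ q ⁆))) → r ∈ (if does d then B [ q ]≔ inside else B) ⇔ r ∈ B
    add (yes _) = ∈-update-other r≢q inside
    add (no _)  = ⇔-refl

  toggle-antichain : IsAntichain P B → IsAntichain P (toggle P q B)
  toggle-antichain {B} {q} antiB p r p∈ r∈ p⊑r with p ≟ q | r ≟ q
  ... | yes refl | yes refl = refl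
  ... | yes refl | no r≢q   = contradiction p⊑r (proj₂ (to (toggle-self antiB) p∈ _ (to (toggle-other r≢q) r∈)))
  ... | no p≢q   | yes refl = contradiction p⊑r (proj₁ (to (toggle-self antiB) r∈ _ (to (toggle-other p≢q) p∈)))
  ... | no p≢q   | no r≢q   = antiB p r (to (toggle-other p≢q) p∈) (to (toggle-other r≢q) r∈) p⊑r

  toggleIfAt : Subset n → ℕ → Fin n → Subset n → Subset n
  toggleIfAt S i q B = if does ((q ∈? S) ×-dec (rk q ℕ.≟ i)) then toggle P q B else B

  toggleIfAt-target : q ∈ S → rk q ≡ i → toggleIfAt S i q B ≡ toggle P q B
  toggleIfAt-target {q} {S} {i} {B} q∈S rk≡i =
    cong (λ b → if b then toggle P q B else B) (dec-true ((q ∈? S) ×-dec (rk q ℕ.≟ i)) (q∈S , rk≡i))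

  toggleIfAt-skip : ¬ (q ∈ S × rk q ≡ i) → toggleIfAt S i q B ≡ B
  toggleIfAt-skip {q} {S} {i} {B} ¬target =
    cong (λ b → if b then toggle P q B else B) (dec-false ((q ∈? S) ×-dec (rk q ℕ.≟ i)) ¬target)

  record RankToggled (S : Subset n) (i : ℕ) (B : Subset n) (qs : List (Fin n)) (B′ : Subset n) : Set where
    field
      antichain : IsAntichain P B′
      toggled   : ∀ {q} → q List.∈ qs → q ∈ S → rk q ≡ i → q ∈ B′ ⇔ Incomparable B q
      untouched : ∀ {q} → ¬ (q List.∈ qs × q ∈ S × rk q ≡ i) → q ∈ B′ ⇔ q ∈ B

  rankToggled-∷ : ∀ {qs B′} → ¬ q List.∈ qs → RankToggled S i B qs B′ →
                  RankToggled S i B (q ∷ qs) (toggleIfAt S i q B′)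
  rankToggled-∷ {q} {S} {i} {B} {qs} {B′} q∉qs T with (q ∈? S) ×-dec (rk q ℕ.≟ i)
  ... | no ¬target = subst (RankToggled S i B (q ∷ qs)) (sym (toggleIfAt-skip ¬target)) record
    { antichain = antichain
    ; toggled   = λ { (here refl) q∈S rk≡i → contradiction (q∈S , rk≡i) ¬target
                    ; (there r∈qs)         → toggled r∈qs }
    ; untouched = λ ¬t → untouched (λ (r∈qs , t) → ¬t (there r∈qs , t))
    }
    where open RankToggled T
  ... | yes (q∈S , rk≡i) = subst (RankToggled S i B (q ∷ qs)) (sym (toggleIfAt-target q∈S rk≡i)) record
    { antichain = toggle-antichain {q = q} antichain
    ; toggled   = λ { (here refl) _ _ → ⇔-trans (toggle-self antichain) (Incomparable-cong agree)
                    ; (there r∈qs) r∈S rk≡ →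
                        ⇔-trans (toggle-other (∈qs⇒≢q r∈qs)) (toggled r∈qs r∈S rk≡) }
    ; untouched = untouched′
    }
    where
    open RankToggled T
    ∈qs⇒≢q : ∀ {r} → r List.∈ qs → r ≢ q
    ∈qs⇒≢q r∈qs refl = q∉qs r∈qs
    -- Whether q can be added depends only on q itself and on elements of other ranks, which the
    -- earlier toggles of rank i have left alone.
    agree : ∀ {b} → rk b ≢ rk q ⊎ b ≡ q → b ∈ B′ ⇔ b ∈ B
    agree (inj₁ rk≢)  = untouched (λ (_ , _ , rk≡) → rk≢ (trans rk≡ (sym rk≡i)))
    agree (inj₂ refl) = untouched (λ (b∈qs , _) → q∉qs b∈qs)
    untouched′ : ∀ {r} → ¬ (r List.∈ q ∷ qs × r ∈ S × rk r ≡ i) → r ∈ toggle P q B′ ⇔ r ∈ B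
    untouched′ {r} ¬t with r ≟ q
    ... | yes refl = contradiction (here refl , q∈S , rk≡i) ¬t
    ... | no r≢q   = ⇔-trans (toggle-other r≢q) (untouched (λ (r∈qs , t) → ¬t (there r∈qs , t)))

  foldr-toggleIfAt : ∀ {qs} → IsAntichain P B → Unique qs → RankToggled S i B qs (foldr (toggleIfAt S i) B qs)
  foldr-toggleIfAt antiB []            = record { antichain = antiB ; toggled = λ () ; untouched = λ _ → ⇔-refl }
  foldr-toggleIfAt antiB (q≢qs ∷ uniq) = rankToggled-∷ (All¬⇒¬Any q≢qs) (foldr-toggleIfAt antiB uniq)

  toggleRank-rankToggled : IsAntichain P B → RankToggled S i B (allFin n) (toggleRank P S i B)
  toggleRank-rankToggled antiB = foldr-toggleIfAt antiB (allFin⁺ n)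

  toggleRank-antichain : IsAntichain P B → IsAntichain P (toggleRank P S i B)
  toggleRank-antichain antiB = RankToggled.antichain (toggleRank-rankToggled antiB)

  toggleRank-target : IsAntichain P B → r ∈ S → rk r ≡ i → r ∈ toggleRank P S i B ⇔ Incomparable B r
  toggleRank-target {r = r} antiB = RankToggled.toggled (toggleRank-rankToggled antiB) (∈-allFin r)

  toggleRank-other : IsAntichain P B → ¬ (r ∈ S × rk r ≡ i) → r ∈ toggleRank P S i B ⇔ r ∈ B
  toggleRank-other antiB ¬target = RankToggled.untouched (toggleRank-rankToggled antiB) (¬target ∘ proj₂)

  toggleRank-⊆ : IsAntichain P B → B ⊆ S → toggleRank P S i B ⊆ S
  toggleRank-⊆ {S = S} antiB B⊆S {r} r∈ with r ∈? S
  ... | yes r∈S = r∈S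
  ... | no r∉S  = B⊆S (to (toggleRank-other antiB (r∉S ∘ proj₁)) r∈)

  toggleRank-above-rank : rankOf P S ℕ.< i → toggleRank P S i B ≡ B
  toggleRank-above-rank {S} {i} {B} rankOf<i = go (allFin n)
    where
    ¬target : ¬ (q ∈ S × rk q ≡ i)
    ¬target (q∈S , rk≡i) = ≤⇒≯ (subst (ℕ._≤ rankOf P S) rk≡i (rk≤rankOf q∈S)) rankOf<i
    go : ∀ qs → foldr (toggleIfAt S i) B qs ≡ B
    go []       = refl
    go (q ∷ qs) = trans (toggleIfAt-skip {q = q} ¬target) (go qs)

  applyRanks-++ : ∀ ks ls → applyRanks P S (ks ++ ls) B ≡ applyRanks P S ls (applyRanks P S ks B)
  applyRanks-++ []       ls = refl
  applyRanks-++ (k ∷ ks) ls = applyRanks-++ ks ls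

  applyRanks-filter : ∀ ks → applyRanks P S ks B ≡ applyRanks P S (filter (ℕ._≤? rankOf P S) ks) B
  applyRanks-filter {S} []       = refl
  applyRanks-filter {S} {B} (k ∷ ks) with k ℕ.≤? rankOf P S
  ... | yes k≤ = trans (applyRanks-filter ks) (cong (λ ls → applyRanks P S ls B) (sym (filter-accept _≤R? k≤)))
    where _≤R? = ℕ._≤? rankOf P S
  ... | no k≰  = begin
    applyRanks P S ks (toggleRank P S k B) ≡⟨ cong (applyRanks P S ks) (toggleRank-above-rank (≰⇒> k≰)) ⟩
    applyRanks P S ks B                    ≡⟨ applyRanks-filter ks ⟩
    applyRanks P S (filter _≤R? ks) B      ≡⟨ cong (λ ls → applyRanks P S ls B) (filter-reject _≤R? k≰) ⟨
    applyRanks P S (filter _≤R? (k ∷ ks)) B ∎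
    where
    open ≡-Reasoning
    _≤R? = ℕ._≤? rankOf P S

  rvacRanks : ℕ → List ℕ
  rvacRanks R = concatMap (λ j → segment P j R) (upTo (suc R))

  segment≡consecutive : ∀ j R → segment P j R ≡ consecutive j (suc R ∸ j)
  segment≡consecutive j R =
    trans (map-applyUpTo id (j +_) (suc R ∸ j)) (applyUpTo≡consecutive j (suc R ∸ j) (λ _ → refl))

  segment-empty : ∀ {j} → ¬ j ℕ.≤ k → segment P j k ≡ []
  segment-empty {k} {j} j≰k = cong (map (j +_) ∘ upTo) (m≤n⇒m∸n≡0 (≰⇒> j≰k))

  filter-segment : k ℕ.≤ R → ∀ j → filter (ℕ._≤? k) (segment P j R) ≡ segment P j k
  filter-segment {k} {R} k≤R j = begin
    filter (ℕ._≤? k) (segment P j R)             ≡⟨ cong (filter (ℕ._≤? k)) (segment≡consecutive j R) ⟩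
    filter (ℕ._≤? k) (consecutive j (suc R ∸ j)) ≡⟨ filter-consecutive k j (suc R ∸ j) ⟩
    consecutive j ((suc R ∸ j) ⊓ (suc k ∸ j))    ≡⟨ cong (consecutive j) (m≥n⇒m⊓n≡n (∸-monoˡ-≤ j (s≤s k≤R))) ⟩
    consecutive j (suc k ∸ j)                    ≡⟨ segment≡consecutive j k ⟨
    segment P j k                                ∎
    where open ≡-Reasoning

  filter-rvacRanks : k ℕ.≤ R → filter (ℕ._≤? k) (rvacRanks R) ≡ rvacRanks k
  filter-rvacRanks {k} {R} k≤R = begin
    filter (ℕ._≤? k) (concatMap (segmentTo R) (upTo (suc R)))
      ≡⟨ filter-concatMap (ℕ._≤? k) (segmentTo R) (upTo (suc R)) ⟩
    concatMap (filter (ℕ._≤? k) ∘ segmentTo R) (upTo (suc R))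
      ≡⟨ concatMap-cong (filter-segment k≤R) (upTo (suc R)) ⟩
    concatMap (segmentTo k) (upTo (suc R))
      ≡⟨ concatMap-filter (ℕ._≤? k) segment-empty (upTo (suc R)) ⟨
    concatMap (segmentTo k) (filter (ℕ._≤? k) (upTo (suc R)))
      ≡⟨ cong (concatMap (segmentTo k)) (filter-upTo k≤R) ⟩
    concatMap (segmentTo k) (upTo (suc k))
      ∎
    where
    open ≡-Reasoning
    segmentTo : ℕ → ℕ → List ℕ
    segmentTo R j = segment P j R

  Rvac-bounded : rankOf P S ℕ.≤ R → Rvac P S B ≡ applyRanks P S (rvacRanks R) B
  Rvac-bounded {S} {R} {B} rankOf≤R = sym (begin
    applyRanks P S (rvacRanks R) B                                ≡⟨ applyRanks-filter (rvacRanks R) ⟩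
    applyRanks P S (filter (ℕ._≤? rankOf P S) (rvacRanks R)) B    ≡⟨ cong (λ ks → applyRanks P S ks B)
                                                                          (filter-rvacRanks rankOf≤R) ⟩
    Rvac P S B                                                    ∎)
    where open ≡-Reasoning

  rowInv-bounded : rankOf P S ℕ.≤ R → rowInv P S B ≡ applyRanks P S (reverse (upTo (suc R))) B
  rowInv-bounded {S} {R} {B} rankOf≤R = sym (begin
    applyRanks P S (reverse (upTo (suc R))) B                    ≡⟨ applyRanks-filter (reverse (upTo (suc R))) ⟩
    applyRanks P S (filter _≤R? (reverse (upTo (suc R)))) B      ≡⟨ cong (λ ks → applyRanks P S ks B) filtered ⟩
    rowInv P S B                                                 ∎)
    where
    open ≡-Reasoning
    _≤R? = ℕ._≤? rankOf P S
    filtered : filter _≤R? (reverse (upTo (suc R))) ≡ reverse (upTo (suc (rankOf P S)))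
    filtered = trans (filter-reverse _≤R? (upTo (suc R))) (cong reverse (filter-upTo rankOf≤R))

  innerRanks : ℕ → List ℕ
  innerRanks R = drop 1 (rvacRanks R) ++ applyDownFrom suc R

  innerRanks-nonzero : ∀ R → All (_≢ 0) (innerRanks R)
  innerRanks-nonzero R =
    ++⁺ (++⁺ (map⁺ (applyUpTo⁺₂ _ R (λ _ ())))
             (concat⁺ (map⁺ (applyUpTo⁺₂ _ R λ j → map⁺ (applyUpTo⁺₂ id (suc R ∸ suc j) (λ _ ()))))))
        (applyDownFrom⁺₂ suc R (λ _ ()))

  rowInv∘Rvac-bounded : rankOf P S ℕ.≤ R →
    rowInv P S (Rvac P S B) ≡ toggleRank P S 0 (applyRanks P S (innerRanks R) (toggleRank P S 0 B))
  rowInv∘Rvac-bounded {S} {R} {B} rankOf≤R = begin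
    rowInv P S (Rvac P S B)
      ≡⟨ rowInv-bounded rankOf≤R ⟩
    applyRanks P S (reverse (upTo (suc R))) (Rvac P S B)
      ≡⟨ cong₂ (applyRanks P S) reverse-upTo≡ (Rvac-bounded rankOf≤R) ⟩
    applyRanks P S (applyDownFrom suc R ++ [ 0 ]) (applyRanks P S rvacTail (toggleRank P S 0 B))
      ≡⟨ applyRanks-++ (applyDownFrom suc R) [ 0 ] ⟩
    toggleRank P S 0 (applyRanks P S (applyDownFrom suc R) (applyRanks P S rvacTail (toggleRank P S 0 B)))
      ≡⟨ cong (toggleRank P S 0) (applyRanks-++ rvacTail (applyDownFrom suc R)) ⟨
    toggleRank P S 0 (applyRanks P S (innerRanks R) (toggleRank P S 0 B))
      ∎
    where
    open ≡-Reasoning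
    rvacTail : List ℕ
    rvacTail = drop 1 (rvacRanks R)
    reverse-upTo≡ : reverse (upTo (suc R)) ≡ applyDownFrom suc R ++ [ 0 ]
    reverse-upTo≡ = trans (reverse-upTo (suc R)) (sym (applyDownFrom-∷ʳ id R))

  ∈-tabulate-dec : ∀ {T : Fin n → Set} (d : ∀ x → Dec (T x)) →
                   r ∈ tabulate (λ x → if does (d x) then inside else outside) ⇔ T r
  ∈-tabulate-dec {r} d = mk⇔
    (λ r∈ → decode (d r) (trans (sym (lookup∘tabulate _ r)) ([]=⇒lookup r∈)))
    (λ t → lookup⇒[]= r _ (trans (lookup∘tabulate _ r) (cong (λ b → if b then inside else outside)
                                                             (dec-true (d r) t))))
    where
    decode : ∀ {A} (a? : Dec A) → (if does a? then inside else outside) ≡ inside → A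
    decode (yes a) _ = a
    decode (no _)  ()

  ∈-supp : r ∈ supp P B ⇔ (rk r ≡ 0 × ∃ λ q → q ∈ B × r ⊑ q)
  ∈-supp {B = B} = ∈-tabulate-dec (λ p → (rk p ℕ.≟ 0) ×-dec any? (λ q → (q ∈? B) ×-dec (p ⊑? q)))

  Excluded : Subset n → Fin n → Set
  Excluded X p = rk p ≡ 0 × p ∉ X

  ∈-PX : q ∈ PX P X ⇔ (∀ p → Excluded X p → ¬ p ⊑ q)
  ∈-PX {X = X} = ∈-tabulate-dec (λ q → all? λ p → ((rk p ℕ.≟ 0) ×-dec ¬? (p ∈? X)) →-dec ¬? (p ⊑? q))

  ⊆-PX-supp : B ⊆ PX P (supp P B)
  ⊆-PX-supp q∈B = from ∈-PX (λ p (rk≡0 , p∉X) p⊑q → p∉X (from ∈-supp (rk≡0 , _ , q∈B , p⊑q)))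

  ⊆PX⇒supp⊆ : B ⊆ PX P X → supp P B ⊆ X
  ⊆PX⇒supp⊆ {X = X} B⊆PX {p} p∈supp with to ∈-supp p∈supp | p ∈? X
  ... | _                    | yes p∈X = p∈X
  ... | rk≡0 , q , q∈B , p⊑q | no p∉X  = contradiction p⊑q (to ∈-PX (B⊆PX q∈B) p (rk≡0 , p∉X))

  ∉PX⇒above-excluded : q ∉ PX P X → ∃ λ p → Excluded X p × p ⊑ q
  ∉PX⇒above-excluded {q} {X} q∉PX with any? (λ p → ((rk p ℕ.≟ 0) ×-dec ¬? (p ∈? X)) ×-dec (p ⊑? q))
  ... | yes witness = witness
  ... | no ∄p       = contradiction (from ∈-PX (λ p excluded p⊑q → ∄p (p , excluded , p⊑q))) q∉PX

  excluded-incomparable-PX : Excluded X p → q ∈ PX P X → ¬ p ⊑ q × ¬ q ⊑ p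
  excluded-incomparable-PX excluded@(rk≡0 , _) q∈PX =
    to ∈-PX q∈PX _ excluded ,
    λ q⊑p → to ∈-PX (subst (_∈ PX P _) (⊑∧rk≡0⇒≡ q⊑p rk≡0) q∈PX) _ excluded ⊑-refl

  Incomparable⇔∉supp : rk p ≡ 0 → Incomparable B p ⇔ p ∉ supp P B
  Incomparable⇔∉supp {p} {B} rk≡0 = mk⇔
    (λ inc p∈supp → let _ , q , q∈B , p⊑q = to ∈-supp p∈supp in proj₂ (inc q q∈B) p⊑q)
    (λ p∉supp q q∈B →
      (λ q⊑p → p∉supp (from ∈-supp (rk≡0 , p , subst (_∈ B) (⊑∧rk≡0⇒≡ q⊑p rk≡0) q∈B , ⊑-refl))) ,
      (λ p⊑q → p∉supp (from ∈-supp (rk≡0 , q , q∈B , p⊑q))))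

  supp-toggleRank₀ : IsAntichain P C → p ∈ S → rk p ≡ 0 → p ∉ C → p ∈ supp P (toggleRank P S 0 C)
  supp-toggleRank₀ {C} {p} antiC p∈S rk≡0 p∉C with any? (λ c → (c ∈? C) ×-dec (p ⊑? c))
  ... | yes (c , c∈C , p⊑c) =
    from ∈-supp (rk≡0 , c , from (toggleRank-other antiC (rk≢0 ∘ proj₂)) c∈C , p⊑c)
    where
    rk≢0 : rk c ≢ 0
    rk≢0 rkc≡0 = p∉C (subst (_∈ C) (sym (⊑∧rk≡0⇒≡ p⊑c rkc≡0)) c∈C)
  ... | no ∄c = from ∈-supp (rk≡0 , p , from (toggleRank-target antiC p∈S rk≡0) incomparable , ⊑-refl)
    where
    incomparable : Incomparable C p
    incomparable c c∈C =
      (λ c⊑p → p∉C (subst (_∈ C) (⊑∧rk≡0⇒≡ c⊑p rk≡0) c∈C)) , (λ p⊑c → ∄c (c , c∈C , p⊑c))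

module Restriction {n : ℕ} (P : RankedPoset n) (A : Subset n) (antiA : IsAntichain P A) where
  open RankedPoset P renaming (_≤_ to _⊑_)
  open IsDecPartialOrder isDecPartialOrder using () renaming (refl to ⊑-refl)

  private
    variable
      r : Fin n
      C D : Subset n
      i : ℕ

  X : Subset n
  X = supp P A

  Q : Subset n
  Q = PX P X

  record Corresponds (C D : Subset n) : Set where
    field
      antichain  : IsAntichain P C
      minimal    : ∀ {r} → rk r ≡ 0 → r ∈ C ⇔ r ∉ X
      positive   : ∀ {r} → rk r ≢ 0 → r ∈ C ⇔ r ∈ D
      D⊆Q        : D ⊆ Q
      D-positive : ∀ {r} → r ∈ D → rk r ≢ 0

    D⊆C : D ⊆ C
    D⊆C r∈D = from (positive (D-positive r∈D)) r∈D

    antichain-D : IsAntichain P D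
    antichain-D p r p∈D r∈D = antichain p r (D⊆C p∈D) (D⊆C r∈D)

    Incomparable-split : Incomparable P C r ⇔ (r ∈ Q × Incomparable P D r)
    Incomparable-split {r} = mk⇔
      (λ inc → r∈Q inc , λ d d∈D → inc d (D⊆C d∈D))
      (λ (r∈Q , inc) c c∈C → incomparable r∈Q inc c∈C (rk c ℕ.≟ 0))
      where
      r∈Q : Incomparable P C r → r ∈ Q
      r∈Q inc with r ∈? Q
      ... | yes r∈Q = r∈Q
      ... | no r∉Q  = let p , (rk≡0 , p∉X) , p⊑r = ∉PX⇒above-excluded P r∉Q
                      in contradiction p⊑r (proj₁ (inc p (from (minimal rk≡0) p∉X)))
      incomparable : ∀ {c} → r ∈ Q → Incomparable P D r → c ∈ C → Dec (rk c ≡ 0) →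
                     ¬ c ⊑ r × ¬ r ⊑ c
      incomparable r∈Q inc c∈C (yes rk≡0) = excluded-incomparable-PX P (rk≡0 , to (minimal rk≡0) c∈C) r∈Q
      incomparable r∈Q inc c∈C (no rk≢0)  = inc _ (to (positive rk≢0) c∈C)

    toggleRank-agrees : rk r ≡ i → r ∈ toggleRank P ⊤ i C ⇔ r ∈ toggleRank P Q i D
    toggleRank-agrees {r} {i} rk≡i with r ∈? Q
    ... | yes r∈Q = ⇔-trans (toggleRank-target P antichain ∈⊤ rk≡i)
                   (⇔-trans (mk⇔ (proj₂ ∘ to Incomparable-split) (from Incomparable-split ∘ (r∈Q ,_)))
                            (⇔-sym (toggleRank-target P antichain-D r∈Q rk≡i)))
    ... | no r∉Q  = mk⇔
      (λ r∈C′ → contradiction (proj₁ (to Incomparable-split (to (toggleRank-target P antichain ∈⊤ rk≡i) r∈C′)))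
                              r∉Q)
      (λ r∈D′ → contradiction (D⊆Q (to (toggleRank-other P antichain-D (r∉Q ∘ proj₁)) r∈D′)) r∉Q)

    toggleRank-agrees-positive : rk r ≢ 0 → r ∈ toggleRank P ⊤ i C ⇔ r ∈ toggleRank P Q i D
    toggleRank-agrees-positive {r} {i} rk≢0 with rk r ℕ.≟ i
    ... | yes rk≡i = toggleRank-agrees rk≡i
    ... | no rk≢i  = ⇔-trans (toggleRank-other P antichain (rk≢i ∘ proj₂))
                    (⇔-trans (positive rk≢0) (⇔-sym (toggleRank-other P antichain-D (rk≢i ∘ proj₂))))

  initial-corresponds : Corresponds (toggleRank P ⊤ 0 A) (toggleRank P Q 0 A)
  initial-corresponds = record
    { antichain  = toggleRank-antichain P antiA
    ; minimal    = λ rk≡0 → ⇔-trans (toggleRank-target P antiA ∈⊤ rk≡0) (Incomparable⇔∉supp P rk≡0)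
    ; positive   = λ rk≢0 → ⇔-trans (toggleRank-other P antiA (rk≢0 ∘ proj₂))
                                    (⇔-sym (toggleRank-other P antiA (rk≢0 ∘ proj₂)))
    ; D⊆Q        = D⊆Q
    ; D-positive = D-positive
    }
    where
    D⊆Q : toggleRank P Q 0 A ⊆ Q
    D⊆Q = toggleRank-⊆ P antiA (⊆-PX-supp P)
    D-positive : r ∈ toggleRank P Q 0 A → rk r ≢ 0
    D-positive r∈D rk≡0 =
      let r∉X = to (Incomparable⇔∉supp P rk≡0) (to (toggleRank-target P antiA (D⊆Q r∈D) rk≡0) r∈D)
      in proj₁ (excluded-incomparable-PX P (rk≡0 , r∉X) (D⊆Q r∈D)) ⊑-refl

  toggleRank-corresponds : i ≢ 0 → Corresponds C D → Corresponds (toggleRank P ⊤ i C) (toggleRank P Q i D)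
  toggleRank-corresponds {i} {C} {D} i≢0 corr = record
    { antichain  = toggleRank-antichain P antichain
    ; minimal    = λ rk≡0 → ⇔-trans (toggleRank-other P antichain (rk≡0⇒≢i rk≡0 ∘ proj₂)) (minimal rk≡0)
    ; positive   = toggleRank-agrees-positive
    ; D⊆Q        = toggleRank-⊆ P antichain-D D⊆Q
    ; D-positive = D-positive′
    }
    where
    open Corresponds corr
    rk≡0⇒≢i : rk r ≡ 0 → rk r ≢ i
    rk≡0⇒≢i rk≡0 rk≡i = i≢0 (trans (sym rk≡i) rk≡0)
    D-positive′ : r ∈ toggleRank P Q i D → rk r ≢ 0
    D-positive′ r∈D′ rk≡0 =
      D-positive (to (toggleRank-other P antichain-D (rk≡0⇒≢i rk≡0 ∘ proj₂)) r∈D′) rk≡0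

  applyRanks-corresponds : ∀ {ks} → All (_≢ 0) ks → Corresponds C D →
                           Corresponds (applyRanks P ⊤ ks C) (applyRanks P Q ks D)
  applyRanks-corresponds []           corr = corr
  applyRanks-corresponds (k≢0 ∷ ks≢0) corr = applyRanks-corresponds ks≢0 (toggleRank-corresponds k≢0 corr)

  final-toggle-agrees : Corresponds C D → toggleRank P ⊤ 0 C ≡ toggleRank P Q 0 D
  final-toggle-agrees {C} {D} corr = ⊆-antisym (to agree) (from agree)
    where
    open Corresponds corr
    agree : r ∈ toggleRank P ⊤ 0 C ⇔ r ∈ toggleRank P Q 0 D
    agree {r} with rk r ℕ.≟ 0
    ... | yes rk≡0 = toggleRank-agrees rk≡0
    ... | no rk≢0  = toggleRank-agrees-positive rk≢0

  final-toggle-supp : Corresponds C D → supp P (toggleRank P ⊤ 0 C) ≡ X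
  final-toggle-supp {C} corr = ⊆-antisym (⊆PX⇒supp⊆ P ⊆Q) ⊇X
    where
    open Corresponds corr
    ⊆Q : toggleRank P ⊤ 0 C ⊆ Q
    ⊆Q r∈ = toggleRank-⊆ P antichain-D D⊆Q (subst (_ ∈_) (final-toggle-agrees corr) r∈)
    ⊇X : X ⊆ supp P (toggleRank P ⊤ 0 C)
    ⊇X x∈X = let rk≡0 = proj₁ (to (∈-supp P) x∈X)
             in supp-toggleRank₀ P antichain ∈⊤ rk≡0 (λ x∈C → to (minimal rk≡0) x∈C x∈X)

lemma3p6 : ∀ {n : ℕ} (P : RankedPoset n) (A : Subset n) → IsAntichain P A →
    (supp P (rowInv P ⊤ (Rvac P ⊤ A)) ≡ supp P A)
    × (rowInv P ⊤ (Rvac P ⊤ A) ≡ rowInv P (PX P (supp P A)) (Rvac P (PX P (supp P A)) A))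
lemma3p6 P A antiA =
  trans (cong (supp P) decompose-P) (final-toggle-supp inner) ,
  trans decompose-P (trans (final-toggle-agrees inner) (sym decompose-Q))
  where
  open Restriction P A antiA
  R : ℕ
  R = rankOf P ⊤
  decompose-P : rowInv P ⊤ (Rvac P ⊤ A)
              ≡ toggleRank P ⊤ 0 (applyRanks P ⊤ (innerRanks P R) (toggleRank P ⊤ 0 A))
  decompose-P = rowInv∘Rvac-bounded P ≤-refl
  decompose-Q : rowInv P Q (Rvac P Q A)
              ≡ toggleRank P Q 0 (applyRanks P Q (innerRanks P R) (toggleRank P Q 0 A))
  decompose-Q = rowInv∘Rvac-bounded P (rankOf-lub P (λ _ → rk≤rankOf P ∈⊤))
  inner : Corresponds (applyRanks P ⊤ (innerRanks P R) (toggleRank P ⊤ 0 A))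
                      (applyRanks P Q (innerRanks P R) (toggleRank P Q 0 A))
  inner = applyRanks-corresponds (innerRanks-nonzero P R) initial-corresponds
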